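{- Let $\sigma$ be a simple permutation that avoids both $2341$ and $4123$. If $\sigma$ contains both $123$ and $3412$, then $\sigma = 5274163$.
   Context: A permutation $\pi$ contains $\tau$ if $\pi$ has a subsequence order-isomorphic to $\tau$; otherwise it avoids $\tau$. An interval of a permutation $\pi(1)\cdots\pi(n)$ is a contiguous subsequence $\pi(i)\pi(i+1)\cdots\pi(j)$ whose set of values is a set of consecutive integers. A permutation is simple if its only intervals are itself and its singletons. -}

module Defs where

open import Data.Nat using (ℕ; _<_; _≤_)
open import Data.Fin using (Fin; toℕ)
open import Data.Fin.Permutation using (Permutation′; _⟨$⟩ʳ_)
open import Data.Vec using (Vec; lookup; _∷_; [])
open import Data.Product using (Σ; ∃; _×_; _,_)
open import Data.Sum using (_⊎_)
open import Data.Empty using (⊥)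
open import Relation.Binary.PropositionalEquality using (_≡_)
open import Function.Bundles using (_⇔_)

-- A permutation of length n: a bijection of Fin n = {0,…,n-1}.
-- Its one-line notation is σ(0) σ(1) … σ(n-1) (0-based values).
Perm : ℕ → Set
Perm = Permutation′

val : ∀ {n} → Perm n → Fin n → ℕ
val σ i = toℕ (σ ⟨$⟩ʳ i)

-- A pattern τ of length k given in one-line notation as a word of naturals
-- (only the relative order of entries matters).
-- σ contains τ: there is a strictly increasing choice of positions
-- e(0) < … < e(k-1) such that σ(e i) < σ(e j) iff τ i < τ j.
Contains : ∀ {n k} → Perm n → Vec ℕ k → Set
Contains {n} {k} σ τ =
  Σ (Fin k → Fin n) λ e →
    (∀ i j → toℕ i < toℕ j → toℕ (e i) < toℕ (e j)) ×
    (∀ i j → (val σ (e i) < val σ (e j)) ⇔ (lookup τ i < lookup τ j))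

Avoids : ∀ {n k} → Perm n → Vec ℕ k → Set
Avoids σ τ = Contains σ τ → ⊥

IsInterval : ∀ {n} → Perm n → Fin n → Fin n → Set
IsInterval {n} σ i j =
  ∀ (a b : Fin n) (v : ℕ) →
    toℕ i ≤ toℕ a → toℕ a ≤ toℕ j →
    toℕ i ≤ toℕ b → toℕ b ≤ toℕ j →
    val σ a ≤ v → v ≤ val σ b →
    Σ (Fin n) λ c → (toℕ i ≤ toℕ c) × (toℕ c ≤ toℕ j) × (val σ c ≡ v)

Simple : ∀ {n} → Perm n → Set
Simple {n} σ =
  ∀ (i j : Fin n) → toℕ i ≤ toℕ j → IsInterval σ i j →
    (i ≡ j) ⊎ ((toℕ i ≡ 0) × (ℕ.suc (toℕ j) ≡ n))
  where import Data.Nat as ℕ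

p123 : Vec ℕ 3
p123 = 1 ∷ 2 ∷ 3 ∷ []

p3412 : Vec ℕ 4
p3412 = 3 ∷ 4 ∷ 1 ∷ 2 ∷ []

p2341 : Vec ℕ 4
p2341 = 2 ∷ 3 ∷ 4 ∷ 1 ∷ []

p4123 : Vec ℕ 4
p4123 = 4 ∷ 1 ∷ 2 ∷ 3 ∷ []

w5274163 : Vec ℕ 7
w5274163 = 5 ∷ 2 ∷ 7 ∷ 4 ∷ 1 ∷ 6 ∷ 3 ∷ []

IsWord : ∀ {n k} → Perm n → Vec ℕ k → Set
IsWord {n} {k} σ w =
  Σ (n ≡ k) λ { _≡_.refl → ∀ i → ℕ.suc (val σ i) ≡ lookup w i }
  where import Data.Nat as ℕ

-- Write 5274163 as a x b y c z d, where a b c d is an occurrence of 3412 and x y z one of 123.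
-- In a simple permutation avoiding 2341 and 4123, no point lies to the lower left or to the upper
-- right of an occurrence of 3412: the points of such a corner would be separated from all the
-- others, making σ a sum α ⊕ β, which no simple permutation of length > 2 is. With these corners
-- empty, pattern avoidance alone forces every 3412 and every 123 to interleave as a x b y c z d.
-- Take such a copy c₁ … c₇ of 5274163 that cannot be improved by moving one of its points further
-- up and left. Then every other point lying between cₖ and the next copy point has its value just
-- below that of cₖ, above the next smaller copy value. These blocks of positions are therefore
-- intervals of σ, and simplicity shrinks each of them to the single point cₖ.
module Submission where

open import Defs
open import Data.Nat using (ℕ; zero; suc; _+_; _<_; _≤_; z≤n; s≤s; s≤s⁻¹; _<?_; _≤?_)
open import Data.Nat.Properties
open import Data.Nat.Induction using (<-wellFounded)
open import Data.Fin as Fin using (Fin; toℕ; fromℕ<; inject₁)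
open import Data.Fin.Patterns using (0F; 1F; 2F; 3F; 4F; 5F; 6F)
open import Data.Fin.Properties using (toℕ-injective; toℕ<n; toℕ-fromℕ<; toℕ-inject₁; all?; any?)
  renaming (_≟_ to _≟ᶠ_)
open import Data.Fin.Permutation using (_⟨$⟩ʳ_; _⟨$⟩ˡ_; inverseˡ; inverseʳ)
open import Data.Vec using (Vec; lookup; _∷_; [])
open import Data.Product using (Σ; ∃; _×_; _,_; proj₁; proj₂)
open import Data.Sum using (_⊎_; inj₁; inj₂; [_,_]′)
open import Data.Empty using (⊥; ⊥-elim)
open import Function using (_∘_)
open import Function.Bundles using (_⇔_; mk⇔; Equivalence)
open import Induction.WellFounded using (Acc; acc)
open import Relation.Binary using (Transitive; tri<; tri≈; tri>)
open import Relation.Binary.PropositionalEquality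
open import Relation.Nullary using (¬_; ¬?; Dec; yes; no)
open import Relation.Nullary.Decidable
  using (True; toWitness; from-yes; _×-dec_; _⊎-dec_; _→-dec_; decidable-stable)
open import Relation.Unary using (Decidable)

chain⇒mono : ∀ {k} {A : Set} {R : A → A → Set} → Transitive R → (f : Fin (suc k) → A) →
             (∀ i → R (f (inject₁ i)) (f (Fin.suc i))) → ∀ {i j} → i Fin.< j → R (f i) (f j)
chain⇒mono {suc k} {R = R} trans f step {0F} {1F} _ = step 0F
chain⇒mono {suc k} {R = R} trans f step {0F} {Fin.suc (Fin.suc j)} _ =
  trans (step 0F) (chain⇒mono {R = R} trans (f ∘ Fin.suc) (step ∘ Fin.suc) {0F} {Fin.suc j} (s≤s z≤n))
chain⇒mono {suc k} {R = R} trans f step {Fin.suc i} {Fin.suc j} (s≤s i<j) =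
  chain⇒mono {R = R} trans (f ∘ Fin.suc) (step ∘ Fin.suc) i<j

successor-chain : ∀ {m} (f : Fin (suc m) → ℕ) → (∀ i → suc (f (inject₁ i)) ≡ f (Fin.suc i)) →
                  ∀ i → f i ≡ f 0F + toℕ i
successor-chain f step 0F = sym (+-identityʳ _)
successor-chain {suc m} f step (Fin.suc i) = begin
  f (Fin.suc i)            ≡⟨ successor-chain (f ∘ Fin.suc) (step ∘ Fin.suc) i ⟩
  f 1F + toℕ i             ≡⟨ cong (_+ toℕ i) (step 0F) ⟨
  suc (f 0F) + toℕ i       ≡⟨ +-suc (f 0F) (toℕ i) ⟨
  f 0F + toℕ (Fin.suc i)   ∎
  where open ≡-Reasoning

chain-squeeze : ∀ {m} b (f : Fin (suc m) → ℕ) → (∀ i → f (inject₁ i) < f (Fin.suc i)) →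
                b ≤ f 0F → f (Fin.fromℕ m) ≤ b + m → ∀ i → f i ≡ b + toℕ i
chain-squeeze {zero} b f step lo hi 0F = ≤-antisym hi (subst (_≤ f 0F) (sym (+-identityʳ b)) lo)
chain-squeeze {suc m} b f step lo hi i = squeeze i
  where
  rest : ∀ i → f (Fin.suc i) ≡ suc b + toℕ i
  rest = chain-squeeze (suc b) (f ∘ Fin.suc) (step ∘ Fin.suc) (≤-trans (s≤s lo) (step 0F))
                       (subst (f (Fin.fromℕ (suc m)) ≤_) (+-suc b m) hi)
  squeeze : ∀ i → f i ≡ b + toℕ i
  squeeze 0F = ≤-antisym (s≤s⁻¹ (subst (suc (f 0F) ≤_) (rest 0F) (step 0F)))
                         (subst (_≤ f 0F) (sym (+-identityʳ b)) lo)
  squeeze (Fin.suc i) = trans (rest i) (sym (+-suc b (toℕ i)))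

least : ∀ {n} (P : Fin n → Set) → Decidable P → ∀ {a} → P a →
        Σ (Fin n) λ l → P l × (∀ u → P u → l Fin.≤ u)
least {suc n} P P? {a} pa with P? 0F
... | yes p₀ = 0F , p₀ , λ _ _ → z≤n
least {suc n} P P? {0F} pa | no ¬p₀ = ⊥-elim (¬p₀ pa)
least {suc n} P P? {Fin.suc a} pa | no ¬p₀ with least (P ∘ Fin.suc) (P? ∘ Fin.suc) pa
... | l , pl , l-least = Fin.suc l , pl , λ { 0F p₀ → ⊥-elim (¬p₀ p₀) ; (Fin.suc u) pu → s≤s (l-least u pu) }

greatest : ∀ {n} (P : Fin n → Set) → Decidable P → ∀ {a} → P a →
           Σ (Fin n) λ r → P r × (∀ u → P u → u Fin.≤ r)
greatest {suc n} P P? {a} pa with any? (P? ∘ Fin.suc)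
... | yes (_ , pb) with greatest (P ∘ Fin.suc) (P? ∘ Fin.suc) pb
...   | r , pr , r-greatest = Fin.suc r , pr , λ { 0F _ → z≤n ; (Fin.suc u) pu → s≤s (r-greatest u pu) }
greatest {suc n} P P? {0F} pa | no none =
  0F , pa , λ { 0F _ → z≤n ; (Fin.suc u) pu → ⊥-elim (none (u , pu)) }
greatest {suc n} P P? {Fin.suc a} pa | no none = ⊥-elim (none (a , pa))

IsOrderOf : ∀ {k} → Vec ℕ k → (Fin k → Fin k) → Set
IsOrderOf τ order = (∀ r → lookup τ (order r) ≡ suc (toℕ r)) × (∀ i → ∃ λ r → order r ≡ i)

isOrderOf? : ∀ {k} (τ : Vec ℕ k) (order : Fin k → Fin k) → Dec (IsOrderOf τ order)
isOrderOf? τ order =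
  all? (λ r → lookup τ (order r) ≟ suc (toℕ r)) ×-dec all? (λ i → any? (λ r → order r ≟ᶠ i))

p2341-order p4123-order : Fin 4 → Fin 4
p2341-order 0F = 3F
p2341-order 1F = 0F
p2341-order 2F = 1F
p2341-order 3F = 2F
p4123-order 0F = 1F
p4123-order 1F = 2F
p4123-order 2F = 3F
p4123-order 3F = 0F

w5274163-order : Fin 7 → Fin 7
w5274163-order 0F = 4F
w5274163-order 1F = 1F
w5274163-order 2F = 6F
w5274163-order 3F = 3F
w5274163-order 4F = 0F
w5274163-order 5F = 5F
w5274163-order 6F = 2F

p2341-ordered : IsOrderOf p2341 p2341-order
p2341-ordered = from-yes (isOrderOf? p2341 p2341-order)

p4123-ordered : IsOrderOf p4123 p4123-order
p4123-ordered = from-yes (isOrderOf? p4123 p4123-order)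

w5274163-ordered : IsOrderOf w5274163 w5274163-order
w5274163-ordered = from-yes (isOrderOf? w5274163 w5274163-order)

w5274163-injective : ∀ i j → lookup w5274163 i ≡ lookup w5274163 j → i ≡ j
w5274163-injective = from-yes (all? λ i → all? λ j → (lookup w5274163 i ≟ lookup w5274163 j) →-dec (i ≟ᶠ j))

Predecessor : Fin 7 → Fin 7 → Set
Predecessor k p = ∀ j → lookup w5274163 j < lookup w5274163 k → lookup w5274163 j ≤ lookup w5274163 p

predecessor? : ∀ k p → Dec (Predecessor k p)
predecessor? k p =
  all? λ j → (lookup w5274163 j <? lookup w5274163 k) →-dec (lookup w5274163 j ≤? lookup w5274163 p)

isWord : ∀ {n k} (σ : Perm n) (w : Vec ℕ k) (e : Fin k → Fin n) → (∀ j → toℕ (e j) ≡ toℕ j) → n ≡ k →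
         (∀ j → suc (val σ (e j)) ≡ lookup w j) → IsWord σ w
isWord σ w e e-positions refl e-values =
  refl , λ i → subst (λ p → suc (val σ p) ≡ lookup w i) (toℕ-injective (e-positions i)) (e-values i)

module Points {n : ℕ} (σ : Perm n) where

  infix 4 _≺_ _≼_ _⊏_ _⊑_ _≺?_ _⊏?_

  _≺_ _≼_ _⊏_ _⊑_ : Fin n → Fin n → Set
  p ≺ q = toℕ p < toℕ q
  p ≼ q = toℕ p ≤ toℕ q
  p ⊏ q = val σ p < val σ q
  p ⊑ q = val σ p ≤ val σ q

  _≺?_ : ∀ p q → Dec (p ≺ q)
  p ≺? q = toℕ p <? toℕ q

  _⊏?_ : ∀ p q → Dec (p ⊏ q)
  p ⊏? q = val σ p <? val σ q

  val-injective : ∀ {p q} → val σ p ≡ val σ q → p ≡ q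
  val-injective {p} {q} eq = begin
    p                  ≡⟨ inverseˡ σ ⟨
    σ ⟨$⟩ˡ (σ ⟨$⟩ʳ p)  ≡⟨ cong (σ ⟨$⟩ˡ_) (toℕ-injective eq) ⟩
    σ ⟨$⟩ˡ (σ ⟨$⟩ʳ q)  ≡⟨ inverseˡ σ ⟩
    q                  ∎
    where open ≡-Reasoning

  point-with-value : ∀ {v} → v < n → Σ (Fin n) λ u → val σ u ≡ v
  point-with-value v<n = σ ⟨$⟩ˡ fromℕ< v<n , trans (cong toℕ (inverseʳ σ)) (toℕ-fromℕ< v<n)

  ≺⇒≢ : ∀ {p q} → p ≺ q → p ≢ q
  ≺⇒≢ p≺q refl = <-irrefl refl p≺q

  ≻⇒≢ : ∀ {p q} → q ≺ p → p ≢ q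
  ≻⇒≢ q≺p refl = <-irrefl refl q≺p

  ⊏⇒≢ : ∀ {p q} → p ⊏ q → p ≢ q
  ⊏⇒≢ p⊏q refl = <-irrefl refl p⊏q

  ⊐⇒≢ : ∀ {p q} → q ⊏ p → p ≢ q
  ⊐⇒≢ q⊏p refl = <-irrefl refl q⊏p

  ≼∧≢⇒≺ : ∀ {p q} → p ≼ q → p ≢ q → p ≺ q
  ≼∧≢⇒≺ p≼q p≢q = ≤∧≢⇒< p≼q (p≢q ∘ toℕ-injective)

  ≼⇒≺⊎≡ : ∀ {p q} → p ≼ q → p ≺ q ⊎ p ≡ q
  ≼⇒≺⊎≡ p≼q with m≤n⇒m<n∨m≡n p≼q
  ... | inj₁ p≺q = inj₁ p≺q
  ... | inj₂ eq = inj₂ (toℕ-injective eq)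

  ⊑⇒⊏⊎≡ : ∀ {p q} → p ⊑ q → p ⊏ q ⊎ p ≡ q
  ⊑⇒⊏⊎≡ p⊑q with m≤n⇒m<n∨m≡n p⊑q
  ... | inj₁ p⊏q = inj₁ p⊏q
  ... | inj₂ eq = inj₂ (val-injective eq)

  ≺-split : ∀ {p q} → p ≢ q → p ≺ q ⊎ q ≺ p
  ≺-split {p} {q} p≢q with <-cmp (toℕ p) (toℕ q)
  ... | tri< p≺q _ _ = inj₁ p≺q
  ... | tri≈ _ eq _ = ⊥-elim (p≢q (toℕ-injective eq))
  ... | tri> _ _ q≺p = inj₂ q≺p

  ⊏-split : ∀ {p q} → p ≢ q → p ⊏ q ⊎ q ⊏ p
  ⊏-split {p} {q} p≢q with <-cmp (val σ p) (val σ q)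
  ... | tri< p⊏q _ _ = inj₁ p⊏q
  ... | tri≈ _ eq _ = ⊥-elim (p≢q (val-injective eq))
  ... | tri> _ _ q⊏p = inj₂ q⊏p

  ≺-by-contra : ∀ {p q} → p ≢ q → (q ≺ p → ⊥) → p ≺ q
  ≺-by-contra p≢q q⊀p = [ (λ p≺q → p≺q) , (λ q≺p → ⊥-elim (q⊀p q≺p)) ]′ (≺-split p≢q)

  ⊏-by-contra : ∀ {p q} → p ≢ q → (q ⊏ p → ⊥) → p ⊏ q
  ⊏-by-contra p≢q q⊄p = [ (λ p⊏q → p⊏q) , (λ q⊏p → ⊥-elim (q⊄p q⊏p)) ]′ (⊏-split p≢q)

  Increasing : ∀ {m} → (Fin m → Fin n) → Set
  Increasing e = ∀ i j → toℕ i < toℕ j → e i ≺ e j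

  increasing⇒≼ : ∀ {m} {e : Fin m → Fin n} → Increasing e → ∀ {i j} → toℕ i ≤ toℕ j → e i ≼ e j
  increasing⇒≼ {e = e} e-increasing {i} {j} i≤j with m≤n⇒m<n∨m≡n i≤j
  ... | inj₁ i<j = <⇒≤ (e-increasing i j i<j)
  ... | inj₂ i≡j = ≤-reflexive (cong (toℕ ∘ e) (toℕ-injective i≡j))

  block-of : ∀ {m} (e : Fin (suc m) → Fin n) → Increasing e → ∀ {u} → e 0F ≼ u →
             Σ (Fin (suc m)) λ k → e k ≼ u × (∀ j → toℕ k < toℕ j → u ≺ e j)
  block-of {zero} e _ e₀≼u = 0F , e₀≼u , λ { 0F () }
  block-of {suc m} e e-increasing {u} e₀≼u with u ≺? e 1F
  ... | yes u≺e₁ =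
    0F , e₀≼u , λ { (Fin.suc j) _ → <-≤-trans u≺e₁ (increasing⇒≼ e-increasing {1F} {Fin.suc j} (s≤s z≤n)) }
  ... | no u⊀e₁ with block-of (e ∘ Fin.suc) (λ i j → e-increasing (Fin.suc i) (Fin.suc j) ∘ s≤s) (≮⇒≥ u⊀e₁)
  ...   | k , eₖ≼u , before = Fin.suc k , eₖ≼u , λ { (Fin.suc j) (s≤s k<j) → before j k<j }

  Occurrence : ∀ {k} → Vec ℕ k → (Fin k → Fin n) → Set
  Occurrence τ e = Increasing e × (∀ i j → (e i ⊏ e j) ⇔ (lookup τ i < lookup τ j))

  occurrence : ∀ {k} (τ : Vec ℕ (suc k)) (order : Fin (suc k) → Fin (suc k)) → IsOrderOf τ order →
               (e : Fin (suc k) → Fin n) → (∀ i → e (inject₁ i) ≺ e (Fin.suc i)) →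
               (∀ r → e (order (inject₁ r)) ⊏ e (order (Fin.suc r))) → Occurrence τ e
  occurrence τ order (τ∘order , onto) e by-position by-value =
    (λ i j → chain⇒mono {R = _≺_} <-trans e by-position) ,
    λ i j → mk⇔ (to (onto i) (onto j)) (from (onto i) (onto j))
    where
    value-mono : ∀ {r s} → r Fin.< s → e (order r) ⊏ e (order s)
    value-mono = chain⇒mono {R = _⊏_} <-trans (e ∘ order) by-value
    from : ∀ {i j} → ∃ (λ r → order r ≡ i) → ∃ (λ s → order s ≡ j) → lookup τ i < lookup τ j → e i ⊏ e j
    from (r , refl) (s , refl) τr<τs = value-mono (s≤s⁻¹ (subst₂ _<_ (τ∘order r) (τ∘order s) τr<τs))
    to : ∀ {i j} → ∃ (λ r → order r ≡ i) → ∃ (λ s → order s ≡ j) → e i ⊏ e j → lookup τ i < lookup τ j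
    to (r , refl) (s , refl) eᵢ⊏eⱼ with <-cmp (toℕ r) (toℕ s)
    ... | tri< r<s _ _ = subst₂ _<_ (sym (τ∘order r)) (sym (τ∘order s)) (s≤s r<s)
    ... | tri≈ _ r≡s _ = ⊥-elim (⊏⇒≢ eᵢ⊏eⱼ (cong (e ∘ order) (toℕ-injective r≡s)))
    ... | tri> _ _ s<r = ⊥-elim (<-asym eᵢ⊏eⱼ (value-mono s<r))

  record Convex (P : Fin n → Set) : Set where
    field
      between-positions : ∀ {a b u} → P a → P b → a ≼ u → u ≼ b → P u
      between-values    : ∀ {a b u} → P a → P b → a ⊑ u → u ⊑ b → P u

  -- The leftmost and the rightmost point of a convex set bound an interval of σ.
  simple⇒convex-everything : Simple σ → (P : Fin n → Set) → Decidable P → Convex P →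
                             ∀ {a b} → P a → P b → a ≢ b → ∀ u → P u
  simple⇒convex-everything simple P P? convex {a} {b} pa pb a≢b = everything
    where
    open Convex convex
    l = proj₁ (least P P? pa)
    pl = proj₁ (proj₂ (least P P? pa))
    l-least = proj₂ (proj₂ (least P P? pa))
    r = proj₁ (greatest P P? pa)
    pr = proj₁ (proj₂ (greatest P P? pa))
    r-greatest = proj₂ (proj₂ (greatest P P? pa))

    interval : IsInterval σ l r
    interval a′ b′ v l≼a′ a′≼r l≼b′ b′≼r a′⊑v v⊑b′ with point-with-value (≤-<-trans v⊑b′ (toℕ<n _))
    ... | u , refl = u , l-least u pu , r-greatest u pu , refl
      where
      pu : P u
      pu = between-values (between-positions pl pr l≼a′ a′≼r) (between-positions pl pr l≼b′ b′≼r) a′⊑v v⊑b′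

    everything : ∀ u → P u
    everything u with simple l r (l-least r pr) interval
    ... | inj₁ l≡r = ⊥-elim (a≢b (toℕ-injective (trans (at-l pa) (sym (at-l pb)))))
      where
      at-l : ∀ {c} → P c → toℕ c ≡ toℕ l
      at-l pc = ≤-antisym (subst (λ x → _ ≼ x) (sym l≡r) (r-greatest _ pc)) (l-least _ pc)
    ... | inj₂ (l≡0 , r≡last) =
      between-positions pl pr (subst (_≤ toℕ u) (sym l≡0) z≤n) (s≤s⁻¹ (subst (toℕ u <_) (sym r≡last) (toℕ<n u)))

  Separated : (Fin n → Set) → Set
  Separated L = ∀ {p q} → L p → ¬ L q → p ≺ q × p ⊏ q

  separated-convex : ∀ {L} → Decidable L → Separated L → Convex L
  separated-convex L? sep = record
    { between-positions = λ {_} {_} {u} _ lb _ u≼b → decidable-stable (L? u) λ ¬lu → <⇒≱ (proj₁ (sep lb ¬lu)) u≼b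
    ; between-values    = λ {_} {_} {u} _ lb _ u⊑b → decidable-stable (L? u) λ ¬lu → <⇒≱ (proj₂ (sep lb ¬lu)) u⊑b
    }

  separated-co-convex : ∀ {L} → Separated L → Convex (¬_ ∘ L)
  separated-co-convex sep = record
    { between-positions = λ ¬la _ a≼u _ lu → <⇒≱ (proj₁ (sep lu ¬la)) a≼u
    ; between-values    = λ ¬la _ a⊑u _ lu → <⇒≱ (proj₂ (sep lu ¬la)) a⊑u
    }

  record Is3412 (a b c d : Fin n) : Set where
    field
      a≺b : a ≺ b
      b≺c : b ≺ c
      c≺d : c ≺ d
      c⊏d : c ⊏ d
      d⊏a : d ⊏ a
      a⊏b : a ⊏ b

    a≺c : a ≺ c
    a≺c = <-trans a≺b b≺c

    b≺d : b ≺ d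
    b≺d = <-trans b≺c c≺d

    a≺d : a ≺ d
    a≺d = <-trans a≺b b≺d

    c⊏a : c ⊏ a
    c⊏a = <-trans c⊏d d⊏a

    d⊏b : d ⊏ b
    d⊏b = <-trans d⊏a a⊏b

    c⊏b : c ⊏ b
    c⊏b = <-trans c⊏a a⊏b

  record Is123 (x y z : Fin n) : Set where
    field
      x≺y : x ≺ y
      y≺z : y ≺ z
      x⊏y : x ⊏ y
      y⊏z : y ⊏ z

    x≺z : x ≺ z
    x≺z = <-trans x≺y y≺z

    x⊏z : x ⊏ z
    x⊏z = <-trans x⊏y y⊏z

  3412-points : Contains σ p3412 → ∃ λ a → ∃ λ b → ∃ λ c → ∃ λ d → Is3412 a b c d
  3412-points (e , increasing , same-order) = e 0F , e 1F , e 2F , e 3F , record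
    { a≺b = increasing 0F 1F ≤-refl
    ; b≺c = increasing 1F 2F ≤-refl
    ; c≺d = increasing 2F 3F ≤-refl
    ; c⊏d = Equivalence.from (same-order 2F 3F) ≤-refl
    ; d⊏a = Equivalence.from (same-order 3F 0F) ≤-refl
    ; a⊏b = Equivalence.from (same-order 0F 1F) ≤-refl
    }

  123-points : Contains σ p123 → ∃ λ x → ∃ λ y → ∃ λ z → Is123 x y z
  123-points (e , increasing , same-order) = e 0F , e 1F , e 2F , record
    { x≺y = increasing 0F 1F ≤-refl
    ; y≺z = increasing 1F 2F ≤-refl
    ; x⊏y = Equivalence.from (same-order 0F 1F) ≤-refl
    ; y⊏z = Equivalence.from (same-order 1F 2F) ≤-refl
    }

  record Copy5274163 : Set where
    field
      c₁ c₂ c₃ c₄ c₅ c₆ c₇ : Fin n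
      c₁≺c₂ : c₁ ≺ c₂
      c₂≺c₃ : c₂ ≺ c₃
      c₃≺c₄ : c₃ ≺ c₄
      c₄≺c₅ : c₄ ≺ c₅
      c₅≺c₆ : c₅ ≺ c₆
      c₆≺c₇ : c₆ ≺ c₇
      c₅⊏c₂ : c₅ ⊏ c₂
      c₂⊏c₇ : c₂ ⊏ c₇
      c₇⊏c₄ : c₇ ⊏ c₄
      c₄⊏c₁ : c₄ ⊏ c₁
      c₁⊏c₆ : c₁ ⊏ c₆
      c₆⊏c₃ : c₆ ⊏ c₃

    c₁≺c₃ : c₁ ≺ c₃
    c₁≺c₃ = <-trans c₁≺c₂ c₂≺c₃

    c₂≺c₄ : c₂ ≺ c₄
    c₂≺c₄ = <-trans c₂≺c₃ c₃≺c₄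

    c₃≺c₅ : c₃ ≺ c₅
    c₃≺c₅ = <-trans c₃≺c₄ c₄≺c₅

    c₄≺c₆ : c₄ ≺ c₆
    c₄≺c₆ = <-trans c₄≺c₅ c₅≺c₆

    c₅≺c₇ : c₅ ≺ c₇
    c₅≺c₇ = <-trans c₅≺c₆ c₆≺c₇

    c₁≺c₄ : c₁ ≺ c₄
    c₁≺c₄ = <-trans c₁≺c₃ c₃≺c₄

    c₁≺c₅ : c₁ ≺ c₅
    c₁≺c₅ = <-trans c₁≺c₄ c₄≺c₅

    c₁≺c₆ : c₁ ≺ c₆
    c₁≺c₆ = <-trans c₁≺c₅ c₅≺c₆

    c₂≺c₆ : c₂ ≺ c₆
    c₂≺c₆ = <-trans c₂≺c₄ c₄≺c₆

    c₂≺c₇ : c₂ ≺ c₇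
    c₂≺c₇ = <-trans c₂≺c₆ c₆≺c₇

    c₃≺c₇ : c₃ ≺ c₇
    c₃≺c₇ = <-trans c₃≺c₅ c₅≺c₇

    c₅⊏c₇ : c₅ ⊏ c₇
    c₅⊏c₇ = <-trans c₅⊏c₂ c₂⊏c₇

    c₂⊏c₄ : c₂ ⊏ c₄
    c₂⊏c₄ = <-trans c₂⊏c₇ c₇⊏c₄

    c₇⊏c₁ : c₇ ⊏ c₁
    c₇⊏c₁ = <-trans c₇⊏c₄ c₄⊏c₁

    c₄⊏c₆ : c₄ ⊏ c₆
    c₄⊏c₆ = <-trans c₄⊏c₁ c₁⊏c₆

    c₁⊏c₃ : c₁ ⊏ c₃
    c₁⊏c₃ = <-trans c₁⊏c₆ c₆⊏c₃

    c₅⊏c₁ : c₅ ⊏ c₁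
    c₅⊏c₁ = <-trans c₅⊏c₇ c₇⊏c₁

    point : Fin 7 → Fin n
    point 0F = c₁
    point 1F = c₂
    point 2F = c₃
    point 3F = c₄
    point 4F = c₅
    point 5F = c₆
    point 6F = c₇

    by-position : ∀ i → point (inject₁ i) ≺ point (Fin.suc i)
    by-position 0F = c₁≺c₂
    by-position 1F = c₂≺c₃
    by-position 2F = c₃≺c₄
    by-position 3F = c₄≺c₅
    by-position 4F = c₅≺c₆
    by-position 5F = c₆≺c₇

    by-value : ∀ r → point (w5274163-order (inject₁ r)) ⊏ point (w5274163-order (Fin.suc r))
    by-value 0F = c₅⊏c₂
    by-value 1F = c₂⊏c₇
    by-value 2F = c₇⊏c₄
    by-value 3F = c₄⊏c₁
    by-value 4F = c₁⊏c₆
    by-value 5F = c₆⊏c₃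

    point-occurrence : Occurrence w5274163 point
    point-occurrence = occurrence w5274163 w5274163-order w5274163-ordered point by-position by-value

    outer-3412 : Is3412 c₁ c₃ c₅ c₇
    outer-3412 = record
      { a≺b = c₁≺c₃ ; b≺c = c₃≺c₅ ; c≺d = c₅≺c₇ ; c⊏d = c₅⊏c₇ ; d⊏a = c₇⊏c₁ ; a⊏b = c₁⊏c₃ }

  weight : Copy5274163 → ℕ
  weight K = toℕ c₁ + (toℕ c₂ + (toℕ c₃ + (toℕ c₄ + (toℕ c₅ + (toℕ c₆ + toℕ c₇)))))
    where open Copy5274163 K

  pattern cell₁ t≺c₁ c₁⊏t t⊏c₆ = inj₁ (t≺c₁ , c₁⊏t , t⊏c₆)
  pattern cell₂ c₁≺t t≺c₂ c₂⊏t t⊏c₇ = inj₂ (inj₁ (c₁≺t , t≺c₂ , c₂⊏t , t⊏c₇))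
  pattern cell₃ c₂≺t t≺c₃ c₃⊏t = inj₂ (inj₂ (inj₁ (c₂≺t , t≺c₃ , c₃⊏t)))
  pattern cell₄ c₃≺t t≺c₄ c₄⊏t t⊏c₁ = inj₂ (inj₂ (inj₂ (inj₁ (c₃≺t , t≺c₄ , c₄⊏t , t⊏c₁))))
  pattern cell₅ c₄≺t t≺c₅ c₅⊏t t⊏c₂ = inj₂ (inj₂ (inj₂ (inj₂ (inj₁ (c₄≺t , t≺c₅ , c₅⊏t , t⊏c₂)))))
  pattern cell₆ c₅≺t t≺c₆ c₆⊏t t⊏c₃ = inj₂ (inj₂ (inj₂ (inj₂ (inj₂ (inj₁ (c₅≺t , t≺c₆ , c₆⊏t , t⊏c₃))))))
  pattern cell₇ c₆≺t t≺c₇ c₇⊏t t⊏c₄ = inj₂ (inj₂ (inj₂ (inj₂ (inj₂ (inj₂ (c₆≺t , t≺c₇ , c₇⊏t , t⊏c₄))))))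

  -- t lies in the i-th cell when t, to the upper left of cᵢ, may replace cᵢ in the copy
  module Moves (K : Copy5274163) where
    open Copy5274163 K

    Cell : Fin n → Set
    Cell t = (t ≺ c₁ × c₁ ⊏ t × t ⊏ c₆)
           ⊎ (c₁ ≺ t × t ≺ c₂ × c₂ ⊏ t × t ⊏ c₇)
           ⊎ (c₂ ≺ t × t ≺ c₃ × c₃ ⊏ t)
           ⊎ (c₃ ≺ t × t ≺ c₄ × c₄ ⊏ t × t ⊏ c₁)
           ⊎ (c₄ ≺ t × t ≺ c₅ × c₅ ⊏ t × t ⊏ c₂)
           ⊎ (c₅ ≺ t × t ≺ c₆ × c₆ ⊏ t × t ⊏ c₃)
           ⊎ (c₆ ≺ t × t ≺ c₇ × c₇ ⊏ t × t ⊏ c₄)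

    cell? : Decidable Cell
    cell? t = (t ≺? c₁ ×-dec c₁ ⊏? t ×-dec t ⊏? c₆)
         ⊎-dec (c₁ ≺? t ×-dec t ≺? c₂ ×-dec c₂ ⊏? t ×-dec t ⊏? c₇)
         ⊎-dec (c₂ ≺? t ×-dec t ≺? c₃ ×-dec c₃ ⊏? t)
         ⊎-dec (c₃ ≺? t ×-dec t ≺? c₄ ×-dec c₄ ⊏? t ×-dec t ⊏? c₁)
         ⊎-dec (c₄ ≺? t ×-dec t ≺? c₅ ×-dec c₅ ⊏? t ×-dec t ⊏? c₂)
         ⊎-dec (c₅ ≺? t ×-dec t ≺? c₆ ×-dec c₆ ⊏? t ×-dec t ⊏? c₃)
         ⊎-dec (c₆ ≺? t ×-dec t ≺? c₇ ×-dec c₇ ⊏? t ×-dec t ⊏? c₄)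

    move : ∀ {t} → Cell t → Σ Copy5274163 λ K′ → weight K′ < weight K
    move {t} (cell₁ t≺c₁ c₁⊏t t⊏c₆) =
      record K { c₁ = t ; c₁≺c₂ = <-trans t≺c₁ c₁≺c₂ ; c₄⊏c₁ = <-trans c₄⊏c₁ c₁⊏t ; c₁⊏c₆ = t⊏c₆ }
      , +-monoˡ-< _ t≺c₁
    move {t} (cell₂ c₁≺t t≺c₂ c₂⊏t t⊏c₇) =
      record K { c₂ = t ; c₁≺c₂ = c₁≺t ; c₂≺c₃ = <-trans t≺c₂ c₂≺c₃ ; c₅⊏c₂ = <-trans c₅⊏c₂ c₂⊏t ; c₂⊏c₇ = t⊏c₇ }
      , +-monoʳ-< (toℕ c₁) (+-monoˡ-< _ t≺c₂)
    move {t} (cell₃ c₂≺t t≺c₃ c₃⊏t) =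
      record K { c₃ = t ; c₂≺c₃ = c₂≺t ; c₃≺c₄ = <-trans t≺c₃ c₃≺c₄ ; c₆⊏c₃ = <-trans c₆⊏c₃ c₃⊏t }
      , +-monoʳ-< (toℕ c₁) (+-monoʳ-< (toℕ c₂) (+-monoˡ-< _ t≺c₃))
    move {t} (cell₄ c₃≺t t≺c₄ c₄⊏t t⊏c₁) =
      record K { c₄ = t ; c₃≺c₄ = c₃≺t ; c₄≺c₅ = <-trans t≺c₄ c₄≺c₅ ; c₇⊏c₄ = <-trans c₇⊏c₄ c₄⊏t ; c₄⊏c₁ = t⊏c₁ }
      , +-monoʳ-< (toℕ c₁) (+-monoʳ-< (toℕ c₂) (+-monoʳ-< (toℕ c₃) (+-monoˡ-< _ t≺c₄)))
    move {t} (cell₅ c₄≺t t≺c₅ c₅⊏t t⊏c₂) =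
      record K { c₅ = t ; c₄≺c₅ = c₄≺t ; c₅≺c₆ = <-trans t≺c₅ c₅≺c₆ ; c₅⊏c₂ = t⊏c₂ }
      , +-monoʳ-< (toℕ c₁) (+-monoʳ-< (toℕ c₂) (+-monoʳ-< (toℕ c₃) (+-monoʳ-< (toℕ c₄) (+-monoˡ-< _ t≺c₅))))
    move {t} (cell₆ c₅≺t t≺c₆ c₆⊏t t⊏c₃) =
      record K { c₆ = t ; c₅≺c₆ = c₅≺t ; c₆≺c₇ = <-trans t≺c₆ c₆≺c₇ ; c₁⊏c₆ = <-trans c₁⊏c₆ c₆⊏t ; c₆⊏c₃ = t⊏c₃ }
      , +-monoʳ-< (toℕ c₁) (+-monoʳ-< (toℕ c₂) (+-monoʳ-< (toℕ c₃) (+-monoʳ-< (toℕ c₄)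
          (+-monoʳ-< (toℕ c₅) (+-monoˡ-< _ t≺c₆)))))
    move {t} (cell₇ c₆≺t t≺c₇ c₇⊏t t⊏c₄) =
      record K { c₇ = t ; c₆≺c₇ = c₆≺t ; c₂⊏c₇ = <-trans c₂⊏c₇ c₇⊏t ; c₇⊏c₄ = t⊏c₄ }
      , +-monoʳ-< (toℕ c₁) (+-monoʳ-< (toℕ c₂) (+-monoʳ-< (toℕ c₃) (+-monoʳ-< (toℕ c₄)
          (+-monoʳ-< (toℕ c₅) (+-monoʳ-< (toℕ c₆) t≺c₇)))))

  Extremal : Copy5274163 → Set
  Extremal K = ∀ {t} → ¬ Moves.Cell K t

  extremal-copy : Copy5274163 → Σ Copy5274163 Extremal
  extremal-copy K = descend K (<-wellFounded (weight K))
    where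
    descend : ∀ K → Acc _<_ (weight K) → Σ Copy5274163 Extremal
    descend K (acc lighter) with any? (Moves.cell? K)
    ... | yes (_ , cell) = descend (proj₁ (Moves.move K cell)) (lighter (proj₂ (Moves.move K cell)))
    ... | no none = K , λ cell → none (_ , cell)

module _ {n} {σ : Perm n} (simple : Simple σ) (avoids-2341 : Avoids σ p2341) (avoids-4123 : Avoids σ p4123) where
  open Points σ

  no-2341 : ∀ {p q r s} → p ≺ q → q ≺ r → r ≺ s → s ⊏ p → p ⊏ q → q ⊏ r → ⊥
  no-2341 {p} {q} {r} {s} p≺q q≺r r≺s s⊏p p⊏q q⊏r =
    avoids-2341 (e , occurrence p2341 p2341-order p2341-ordered e by-position by-value)
    where
    e : Fin 4 → Fin n
    e = lookup (p ∷ q ∷ r ∷ s ∷ [])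
    by-position : ∀ i → e (inject₁ i) ≺ e (Fin.suc i)
    by-position 0F = p≺q
    by-position 1F = q≺r
    by-position 2F = r≺s
    by-value : ∀ i → e (p2341-order (inject₁ i)) ⊏ e (p2341-order (Fin.suc i))
    by-value 0F = s⊏p
    by-value 1F = p⊏q
    by-value 2F = q⊏r

  no-4123 : ∀ {p q r s} → p ≺ q → q ≺ r → r ≺ s → q ⊏ r → r ⊏ s → s ⊏ p → ⊥
  no-4123 {p} {q} {r} {s} p≺q q≺r r≺s q⊏r r⊏s s⊏p =
    avoids-4123 (e , occurrence p4123 p4123-order p4123-ordered e by-position by-value)
    where
    e : Fin 4 → Fin n
    e = lookup (p ∷ q ∷ r ∷ s ∷ [])
    by-position : ∀ i → e (inject₁ i) ≺ e (Fin.suc i)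
    by-position 0F = p≺q
    by-position 1F = q≺r
    by-position 2F = r≺s
    by-value : ∀ i → e (p4123-order (inject₁ i)) ⊏ e (p4123-order (Fin.suc i))
    by-value 0F = q⊏r
    by-value 1F = r⊏s
    by-value 2F = s⊏p

  module Corners {a b c d} (Q : Is3412 a b c d) where
    open Is3412 Q

    sw-separated : Separated (λ t → t ≺ a × t ⊏ c)
    sw-separated {s} {t} (s≺a , s⊏c) t∉ = s≺t , s⊏t
      where
      s≢t : s ≢ t
      s≢t refl = t∉ (s≺a , s⊏c)
      s≺t : s ≺ t
      s≺t = ≺-by-contra s≢t λ t≺s →
        let t≺a = <-trans t≺s s≺a
            c⊏t = ⊏-by-contra (≻⇒≢ (<-trans t≺a a≺c)) λ t⊏c → t∉ (t≺a , t⊏c)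
        in [ (λ t⊏a → no-2341 t≺a a≺b b≺c c⊏t t⊏a a⊏b)
           , (λ a⊏t → no-4123 t≺s (<-trans s≺a a≺c) c≺d s⊏c c⊏d (<-trans d⊏a a⊏t))
           ]′ (⊏-split (≺⇒≢ t≺a))
      s⊏t : s ⊏ t
      s⊏t = ⊏-by-contra s≢t λ t⊏s →
        let t⊏c = <-trans t⊏s s⊏c
            a≺t = ≺-by-contra (⊐⇒≢ (<-trans t⊏c c⊏a)) λ t≺a → t∉ (t≺a , t⊏c)
        in [ (λ t≺b → no-4123 a≺t (<-trans t≺b b≺c) c≺d t⊏c c⊏d d⊏a)
           , (λ b≺t → no-2341 s≺a a≺b b≺t t⊏s (<-trans s⊏c c⊏a) a⊏b)
           ]′ (≺-split (⊏⇒≢ (<-trans t⊏c c⊏b)))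

    ne-separated : Separated (λ t → ¬ (d ≺ t × b ⊏ t))
    ne-separated {s} {t} s∉ t∉∉ = s≺t , s⊏t
      where
      t∈ : d ≺ t × b ⊏ t
      t∈ = decidable-stable (d ≺? t ×-dec b ⊏? t) t∉∉
      d≺t = proj₁ t∈
      b⊏t = proj₂ t∈
      s≢t : s ≢ t
      s≢t refl = t∉∉ s∉
      s≺t : s ≺ t
      s≺t = ≺-by-contra s≢t λ t≺s →
        let d≺s = <-trans d≺t t≺s
            s⊏b = ⊏-by-contra (≻⇒≢ (<-trans b≺d d≺s)) λ b⊏s → s∉ (d≺s , b⊏s)
        in [ (λ s⊏d → no-2341 a≺b (<-trans b≺d d≺t) t≺s (<-trans s⊏d d⊏a) a⊏b b⊏t)
           , (λ d⊏s → no-4123 b≺c c≺d d≺s c⊏d d⊏s s⊏b)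
           ]′ (⊏-split (≻⇒≢ d≺s))
      s⊏t : s ⊏ t
      s⊏t = ⊏-by-contra s≢t λ t⊏s →
        let b⊏s = <-trans b⊏t t⊏s
            s≺d = ≺-by-contra (⊐⇒≢ (<-trans d⊏b b⊏s)) λ d≺s → s∉ (d≺s , b⊏s)
        in [ (λ s≺c → no-4123 s≺c c≺d d≺t c⊏d (<-trans d⊏b b⊏t) t⊏s)
           , (λ c≺s → no-2341 a≺b (<-trans b≺c c≺s) s≺d d⊏a a⊏b b⊏s)
           ]′ (≺-split (⊐⇒≢ (<-trans c⊏b b⊏s)))

    sw-empty : ∀ {t} → t ≺ a → t ⊏ c → ⊥
    sw-empty {t} t≺a t⊏c =
      simple⇒convex-everything simple _ (λ u → ¬? (u ≺? a ×-dec u ⊏? c)) (separated-co-convex sw-separated)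
        (λ (a≺a , _) → <-irrefl refl a≺a) (λ (b≺a , _) → <-asym a≺b b≺a) (≺⇒≢ a≺b) t (t≺a , t⊏c)

    ne-empty : ∀ {t} → d ≺ t → b ⊏ t → ⊥
    ne-empty {t} d≺t b⊏t =
      simple⇒convex-everything simple _ ne? (separated-convex ne? ne-separated)
        (λ (d≺a , _) → <-asym a≺d d≺a) (λ (d≺b , _) → <-asym b≺d d≺b) (≺⇒≢ a≺b) t (d≺t , b⊏t)
      where
      ne? : Decidable (λ u → ¬ (d ≺ u × b ⊏ u))
      ne? u = ¬? (d ≺? u ×-dec b ⊏? u)

    ≼a⇒a⊑ : ∀ {t} → t ≼ a → a ⊑ t
    ≼a⇒a⊑ t≼a with ≼⇒≺⊎≡ t≼a
    ... | inj₂ refl = ≤-refl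
    ... | inj₁ t≺a = <⇒≤ (⊏-by-contra (≻⇒≢ t≺a) λ t⊏a →
      [ sw-empty t≺a
      , (λ c⊏t → no-2341 t≺a a≺b b≺c c⊏t t⊏a a⊏b)
      ]′ (⊏-split (≺⇒≢ (<-trans t≺a a≺c))))

    d≼⇒⊑d : ∀ {t} → d ≼ t → t ⊑ d
    d≼⇒⊑d d≼t with ≼⇒≺⊎≡ d≼t
    ... | inj₂ refl = ≤-refl
    ... | inj₁ d≺t = <⇒≤ (⊏-by-contra (≻⇒≢ d≺t) λ d⊏t →
      [ (λ t⊏b → no-4123 b≺c c≺d d≺t c⊏d d⊏t t⊏b)
      , ne-empty d≺t
      ]′ (⊏-split (≻⇒≢ (<-trans b≺d d≺t))))

    ⊑c⇒c≼ : ∀ {t} → t ⊑ c → c ≼ t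
    ⊑c⇒c≼ t⊑c with ⊑⇒⊏⊎≡ t⊑c
    ... | inj₂ refl = ≤-refl
    ... | inj₁ t⊏c = <⇒≤ (≺-by-contra (⊐⇒≢ t⊏c) λ t≺c →
      [ (λ t≺a → sw-empty t≺a t⊏c)
      , (λ a≺t → no-4123 a≺t t≺c c≺d t⊏c c⊏d d⊏a)
      ]′ (≺-split (⊏⇒≢ (<-trans t⊏c c⊏a))))

    b⊑⇒≼b : ∀ {t} → b ⊑ t → t ≼ b
    b⊑⇒≼b b⊑t with ⊑⇒⊏⊎≡ b⊑t
    ... | inj₂ refl = ≤-refl
    ... | inj₁ b⊏t = <⇒≤ (≺-by-contra (⊐⇒≢ b⊏t) λ b≺t →
      [ (λ t≺d → no-2341 a≺b b≺t t≺d d⊏a a⊏b b⊏t)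
      , (λ d≺t → ne-empty d≺t b⊏t)
      ]′ (≺-split (⊐⇒≢ (<-trans d⊏b b⊏t))))

  module Interleaving {a b c d x y z} (Q : Is3412 a b c d) (I : Is123 x y z) where
    open Is3412 Q
    open Is123 I
    open Corners Q using (≼a⇒a⊑; d≼⇒⊑d; ⊑c⇒c≼; b⊑⇒≼b)

    a≺x : a ≺ x
    a≺x = decidable-stable (a ≺? x) λ a⊀x →
      let d⊏x = <-≤-trans d⊏a (≼a⇒a⊑ (≮⇒≥ a⊀x))
          z≺d = decidable-stable (z ≺? d) λ z⊀d → <⇒≱ (<-trans d⊏x x⊏z) (d≼⇒⊑d (≮⇒≥ z⊀d))
      in no-2341 x≺y y≺z z≺d d⊏x x⊏y y⊏z

    z≺d : z ≺ d
    z≺d = decidable-stable (z ≺? d) λ z⊀d → no-4123 a≺x x≺y y≺z x⊏y y⊏z (≤-<-trans (d≼⇒⊑d (≮⇒≥ z⊀d)) d⊏a)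

    c⊏x : c ⊏ x
    c⊏x = decidable-stable (c ⊏? x) λ c⊄x →
      let b≺x = <-≤-trans b≺c (⊑c⇒c≼ (≮⇒≥ c⊄x))
          z⊏b = decidable-stable (z ⊏? b) λ z⊄b → <⇒≱ (<-trans b≺x x≺z) (b⊑⇒≼b (≮⇒≥ z⊄b))
      in no-4123 b≺x x≺y y≺z x⊏y y⊏z z⊏b

    z⊏b : z ⊏ b
    z⊏b = decidable-stable (z ⊏? b) λ z⊄b → no-2341 x≺y y≺z (≤-<-trans (b⊑⇒≼b (≮⇒≥ z⊄b)) b≺c) c⊏x x⊏y y⊏z

    x≺b : x ≺ b
    x≺b = ≺-by-contra (⊏⇒≢ (<-trans x⊏z z⊏b)) λ b≺x → no-4123 b≺x x≺y y≺z x⊏y y⊏z z⊏b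

    c≺z : c ≺ z
    c≺z = ≺-by-contra (⊏⇒≢ (<-trans c⊏x x⊏z)) λ z≺c → no-2341 x≺y y≺z z≺c c⊏x x⊏y y⊏z

    x⊏d : x ⊏ d
    x⊏d = ⊏-by-contra (≺⇒≢ (<-trans x≺z z≺d)) λ d⊏x → no-2341 x≺y y≺z z≺d d⊏x x⊏y y⊏z

    a⊏z : a ⊏ z
    a⊏z = ⊏-by-contra (≺⇒≢ (<-trans a≺x x≺z)) λ z⊏a → no-4123 a≺x x≺y y≺z x⊏y y⊏z z⊏a

    y⊏a : y ⊏ a
    y⊏a = ⊏-by-contra (≻⇒≢ (<-trans a≺x x≺y)) λ a⊏y → no-2341 (<-trans a≺x x≺y) y≺z z≺d d⊏a a⊏y y⊏z

    d⊏y : d ⊏ y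
    d⊏y = ⊏-by-contra (≻⇒≢ (<-trans y≺z z≺d)) λ y⊏d → no-4123 a≺x x≺y (<-trans y≺z z≺d) x⊏y y⊏d d⊏a

    b≺y : b ≺ y
    b≺y = ≺-by-contra (⊐⇒≢ (<-trans y⊏a a⊏b)) λ y≺b → no-2341 x≺y y≺b b≺c c⊏x x⊏y (<-trans y⊏a a⊏b)

    y≺c : y ≺ c
    y≺c = ≺-by-contra (⊐⇒≢ (<-trans c⊏x x⊏y)) λ c≺y → no-4123 b≺c c≺y y≺z (<-trans c⊏x x⊏y) y⊏z z⊏b

    copy : Copy5274163
    copy = record
      { c₁≺c₂ = a≺x ; c₂≺c₃ = x≺b ; c₃≺c₄ = b≺y ; c₄≺c₅ = y≺c ; c₅≺c₆ = c≺z ; c₆≺c₇ = z≺d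
      ; c₅⊏c₂ = c⊏x ; c₂⊏c₇ = x⊏d ; c₇⊏c₄ = d⊏y ; c₄⊏c₁ = y⊏a ; c₁⊏c₆ = a⊏z ; c₆⊏c₃ = z⊏b
      }

  -- Each gap lemma compares the value of t with consecutive copy values; every range but one
  -- yields 2341, 4123, a point in an empty corner of c₁ c₃ c₅ c₇, or a cell of the copy.
  module Gaps (K : Copy5274163) (extremal : Extremal K) where
    open Copy5274163 K
    open Corners outer-3412 using (sw-empty; ne-empty)

    gap₀ : ∀ {t} → t ≺ c₁ → ⊥
    gap₀ t≺c₁
      with ⊏-split (≺⇒≢ (<-trans t≺c₁ c₁≺c₅)) | ⊏-split (≺⇒≢ t≺c₁) | ⊏-split (≺⇒≢ (<-trans t≺c₁ c₁≺c₆))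
    ... | inj₁ t⊏c₅ | _ | _ = sw-empty t≺c₁ t⊏c₅
    ... | inj₂ c₅⊏t | inj₁ t⊏c₁ | _ = no-2341 t≺c₁ c₁≺c₃ c₃≺c₅ c₅⊏t t⊏c₁ c₁⊏c₃
    ... | _ | inj₂ c₁⊏t | inj₁ t⊏c₆ = extremal (cell₁ t≺c₁ c₁⊏t t⊏c₆)
    ... | _ | _ | inj₂ c₆⊏t = no-4123 (<-trans t≺c₁ c₁≺c₂) c₂≺c₄ c₄≺c₆ c₂⊏c₄ c₄⊏c₆ c₆⊏t

    gap₁ : ∀ {t} → c₁ ≺ t → t ≺ c₂ → c₄ ⊏ t × t ⊏ c₁
    gap₁ c₁≺t t≺c₂
      with ⊏-split (≺⇒≢ t≺c₂) | ⊏-split (≺⇒≢ (<-trans t≺c₂ c₂≺c₇)) | ⊏-split (≺⇒≢ (<-trans t≺c₂ c₂≺c₄))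
         | ⊏-split (≻⇒≢ c₁≺t) | ⊏-split (≺⇒≢ (<-trans t≺c₂ c₂≺c₆))
    ... | inj₁ t⊏c₂ | _ | _ | _ | _ = ⊥-elim (no-4123 c₁≺t t≺c₂ c₂≺c₄ t⊏c₂ c₂⊏c₄ c₄⊏c₁)
    ... | inj₂ c₂⊏t | inj₁ t⊏c₇ | _ | _ | _ = ⊥-elim (extremal (cell₂ c₁≺t t≺c₂ c₂⊏t t⊏c₇))
    ... | _ | inj₂ c₇⊏t | inj₁ t⊏c₄ | _ | _ = ⊥-elim (no-2341 (<-trans t≺c₂ c₂≺c₄) c₄≺c₆ c₆≺c₇ c₇⊏t t⊏c₄ c₄⊏c₆)
    ... | _ | _ | inj₂ c₄⊏t | inj₁ t⊏c₁ | _ = c₄⊏t , t⊏c₁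
    ... | _ | _ | _ | inj₂ c₁⊏t | inj₁ t⊏c₆ =
      ⊥-elim (no-2341 c₁≺t (<-trans t≺c₂ c₂≺c₃) c₃≺c₅ c₅⊏c₁ c₁⊏t (<-trans t⊏c₆ c₆⊏c₃))
    ... | _ | _ | _ | _ | inj₂ c₆⊏t = ⊥-elim (no-4123 t≺c₂ c₂≺c₄ c₄≺c₆ c₂⊏c₄ c₄⊏c₆ c₆⊏t)

    gap₂ : ∀ {t} → c₂ ≺ t → t ≺ c₃ → c₅ ⊏ t × t ⊏ c₂
    gap₂ c₂≺t t≺c₃
      with ⊏-split (≺⇒≢ (<-trans t≺c₃ c₃≺c₅)) | ⊏-split (≻⇒≢ c₂≺t) | ⊏-split (≺⇒≢ t≺c₃)
    ... | inj₁ t⊏c₅ | _ | _ = ⊥-elim (no-4123 (<-trans c₁≺c₂ c₂≺t) (<-trans t≺c₃ c₃≺c₅) c₅≺c₇ t⊏c₅ c₅⊏c₇ c₇⊏c₁)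
    ... | inj₂ c₅⊏t | inj₁ t⊏c₂ | _ = c₅⊏t , t⊏c₂
    ... | _ | inj₂ c₂⊏t | inj₁ t⊏c₃ = ⊥-elim (no-2341 c₂≺t t≺c₃ c₃≺c₅ c₅⊏c₂ c₂⊏t t⊏c₃)
    ... | _ | _ | inj₂ c₃⊏t = ⊥-elim (extremal (cell₃ c₂≺t t≺c₃ c₃⊏t))

    gap₃ : ∀ {t} → c₃ ≺ t → t ≺ c₄ → c₆ ⊏ t × t ⊏ c₃
    gap₃ c₃≺t t≺c₄
      with ⊏-split (≺⇒≢ t≺c₄) | ⊏-split (≻⇒≢ (<-trans c₁≺c₃ c₃≺t)) | ⊏-split (≺⇒≢ (<-trans t≺c₄ c₄≺c₆))
         | ⊏-split (≻⇒≢ c₃≺t)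
    ... | inj₁ t⊏c₄ | _ | _ | _ = ⊥-elim (no-4123 c₃≺t t≺c₄ c₄≺c₆ t⊏c₄ c₄⊏c₆ c₆⊏c₃)
    ... | inj₂ c₄⊏t | inj₁ t⊏c₁ | _ | _ = ⊥-elim (extremal (cell₄ c₃≺t t≺c₄ c₄⊏t t⊏c₁))
    ... | _ | inj₂ c₁⊏t | inj₁ t⊏c₆ | _ =
      ⊥-elim (no-2341 (<-trans c₁≺c₃ c₃≺t) (<-trans t≺c₄ c₄≺c₆) c₆≺c₇ c₇⊏c₁ c₁⊏t t⊏c₆)
    ... | _ | _ | inj₂ c₆⊏t | inj₁ t⊏c₃ = c₆⊏t , t⊏c₃
    ... | _ | _ | _ | inj₂ c₃⊏t = ⊥-elim (no-2341 c₁≺c₃ c₃≺t (<-trans t≺c₄ c₄≺c₅) c₅⊏c₁ c₁⊏c₃ c₃⊏t)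

    gap₄ : ∀ {t} → c₄ ≺ t → t ≺ c₅ → c₇ ⊏ t × t ⊏ c₄
    gap₄ c₄≺t t≺c₅
      with ⊏-split (≺⇒≢ t≺c₅) | ⊏-split (≻⇒≢ (<-trans c₂≺c₄ c₄≺t)) | ⊏-split (≺⇒≢ (<-trans t≺c₅ c₅≺c₇))
         | ⊏-split (≻⇒≢ c₄≺t)
    ... | inj₁ t⊏c₅ | _ | _ | _ = ⊥-elim (no-4123 (<-trans c₁≺c₄ c₄≺t) t≺c₅ c₅≺c₇ t⊏c₅ c₅⊏c₇ c₇⊏c₁)
    ... | inj₂ c₅⊏t | inj₁ t⊏c₂ | _ | _ = ⊥-elim (extremal (cell₅ c₄≺t t≺c₅ c₅⊏t t⊏c₂))
    ... | _ | inj₂ c₂⊏t | inj₁ t⊏c₇ | _ =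
      ⊥-elim (no-4123 c₁≺c₂ (<-trans c₂≺c₄ c₄≺t) (<-trans t≺c₅ c₅≺c₇) c₂⊏t t⊏c₇ c₇⊏c₁)
    ... | _ | _ | inj₂ c₇⊏t | inj₁ t⊏c₄ = c₇⊏t , t⊏c₄
    ... | _ | _ | _ | inj₂ c₄⊏t = ⊥-elim (no-2341 c₂≺c₄ c₄≺t t≺c₅ c₅⊏c₂ c₂⊏c₄ c₄⊏t)

    gap₅ : ∀ {t} → c₅ ≺ t → t ≺ c₆ → t ⊏ c₅
    gap₅ c₅≺t t≺c₆
      with ⊏-split (≻⇒≢ c₅≺t) | ⊏-split (≺⇒≢ t≺c₆) | ⊏-split (≻⇒≢ (<-trans c₃≺c₅ c₅≺t))
    ... | inj₁ t⊏c₅ | _ | _ = t⊏c₅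
    ... | inj₂ c₅⊏t | inj₁ t⊏c₆ | _ = ⊥-elim (no-4123 c₃≺c₅ c₅≺t t≺c₆ c₅⊏t t⊏c₆ c₆⊏c₃)
    ... | _ | inj₂ c₆⊏t | inj₁ t⊏c₃ = ⊥-elim (extremal (cell₆ c₅≺t t≺c₆ c₆⊏t t⊏c₃))
    ... | _ | _ | inj₂ c₃⊏t = ⊥-elim (no-2341 c₁≺c₃ (<-trans c₃≺c₅ c₅≺t) (<-trans t≺c₆ c₆≺c₇) c₇⊏c₁ c₁⊏c₃ c₃⊏t)

    gap₆ : ∀ {t} → c₆ ≺ t → t ≺ c₇ → c₁ ⊏ t × t ⊏ c₆
    gap₆ c₆≺t t≺c₇
      with ⊏-split (≻⇒≢ (<-trans c₂≺c₆ c₆≺t)) | ⊏-split (≺⇒≢ t≺c₇) | ⊏-split (≻⇒≢ (<-trans c₄≺c₆ c₆≺t))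
         | ⊏-split (≻⇒≢ (<-trans c₁≺c₆ c₆≺t)) | ⊏-split (≻⇒≢ c₆≺t)
    ... | inj₁ t⊏c₂ | _ | _ | _ | _ = ⊥-elim (no-2341 c₂≺c₄ c₄≺c₆ c₆≺t t⊏c₂ c₂⊏c₄ c₄⊏c₆)
    ... | inj₂ c₂⊏t | inj₁ t⊏c₇ | _ | _ | _ =
      ⊥-elim (no-4123 c₁≺c₅ (<-trans c₅≺c₆ c₆≺t) t≺c₇ (<-trans c₅⊏c₂ c₂⊏t) t⊏c₇ c₇⊏c₁)
    ... | _ | inj₂ c₇⊏t | inj₁ t⊏c₄ | _ | _ = ⊥-elim (extremal (cell₇ c₆≺t t≺c₇ c₇⊏t t⊏c₄))
    ... | _ | _ | inj₂ c₄⊏t | inj₁ t⊏c₁ | _ = ⊥-elim (no-4123 c₁≺c₂ c₂≺c₄ (<-trans c₄≺c₆ c₆≺t) c₂⊏c₄ c₄⊏t t⊏c₁)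
    ... | _ | _ | _ | inj₂ c₁⊏t | inj₁ t⊏c₆ = c₁⊏t , t⊏c₆
    ... | _ | _ | _ | _ | inj₂ c₆⊏t = ⊥-elim (no-2341 c₁≺c₆ c₆≺t t≺c₇ c₇⊏c₁ c₁⊏c₆ c₆⊏t)

    gap₇ : ∀ {t} → c₇ ≺ t → c₂ ⊏ t × t ⊏ c₇
    gap₇ c₇≺t
      with ⊏-split (≻⇒≢ (<-trans c₂≺c₇ c₇≺t)) | ⊏-split (≻⇒≢ c₇≺t) | ⊏-split (≻⇒≢ (<-trans c₃≺c₇ c₇≺t))
    ... | inj₁ t⊏c₂ | _ | _ = ⊥-elim (no-2341 c₂≺c₄ c₄≺c₆ (<-trans c₆≺c₇ c₇≺t) t⊏c₂ c₂⊏c₄ c₄⊏c₆)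
    ... | inj₂ c₂⊏t | inj₁ t⊏c₇ | _ = c₂⊏t , t⊏c₇
    ... | _ | inj₂ c₇⊏t | inj₁ t⊏c₃ = ⊥-elim (no-4123 c₃≺c₅ c₅≺c₇ c₇≺t c₅⊏c₇ c₇⊏t t⊏c₃)
    ... | _ | _ | inj₂ c₃⊏t = ⊥-elim (ne-empty c₇≺t c₃⊏t)

  module Blocks (K : Copy5274163) (extremal : Extremal K) where
    open Copy5274163 K
    open Gaps K extremal

    InBlock : Fin 7 → Fin n → Set
    InBlock k u = point k ≼ u × (∀ j → toℕ k < toℕ j → u ≺ point j)

    InRow : Fin 7 → Fin n → Set
    InRow k u = (∀ j → lookup w5274163 j < lookup w5274163 k → point j ⊏ u) × u ⊑ point k

    point-increasing : Increasing point
    point-increasing = proj₁ point-occurrence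

    own-block : ∀ k → InBlock k (point k)
    own-block k = ≤-refl , point-increasing k

    own-row : ∀ k → InRow k (point k)
    own-row k = (λ j lt → Equivalence.from (proj₂ point-occurrence j k) lt) , ≤-refl

    rows-disjoint : ∀ {j k u} → InRow j u → InRow k u → j ≡ k
    rows-disjoint {j} {k} (below-j , u⊑j) (below-k , u⊑k)
      with <-cmp (lookup w5274163 j) (lookup w5274163 k)
    ... | tri< j<k _ _ = ⊥-elim (<⇒≱ (below-k j j<k) u⊑j)
    ... | tri≈ _ j≡k _ = w5274163-injective j k j≡k
    ... | tri> _ _ k<j = ⊥-elim (<⇒≱ (below-j k k<j) u⊑k)

    in-row-above : ∀ k p {_ : True (predecessor? k p)} {u} → point p ⊏ u → u ⊑ point k → InRow k u
    in-row-above k p {pred} p⊏u u⊑k = below , u⊑k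
      where
      below : ∀ j → lookup w5274163 j < lookup w5274163 k → point j ⊏ _
      below j j<k with m≤n⇒m<n∨m≡n (toWitness pred j j<k)
      ... | inj₁ j<p = <-trans (Equivalence.from (proj₂ point-occurrence j p) j<p) p⊏u
      ... | inj₂ j≡p = subst (λ i → point i ⊏ _) (sym (w5274163-injective j p j≡p)) p⊏u

    in-lowest-row : ∀ {u} → u ⊑ c₅ → InRow 4F u
    in-lowest-row u⊑c₅ = (λ j j<1 → ⊥-elim (lowest j j<1)) , u⊑c₅
      where
      lowest : ∀ j → ¬ lookup w5274163 j < 1
      lowest = from-yes (all? λ j → ¬? (lookup w5274163 j <? 1))

    row-of-gap : ∀ k {u} → point k ≺ u → (∀ j → toℕ k < toℕ j → u ≺ point j) → InRow k u
    row-of-gap 0F c₁≺u before with gap₁ c₁≺u (before 1F ≤-refl)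
    ... | c₄⊏u , u⊏c₁ = in-row-above 0F 3F c₄⊏u (<⇒≤ u⊏c₁)
    row-of-gap 1F c₂≺u before with gap₂ c₂≺u (before 2F ≤-refl)
    ... | c₅⊏u , u⊏c₂ = in-row-above 1F 4F c₅⊏u (<⇒≤ u⊏c₂)
    row-of-gap 2F c₃≺u before with gap₃ c₃≺u (before 3F ≤-refl)
    ... | c₆⊏u , u⊏c₃ = in-row-above 2F 5F c₆⊏u (<⇒≤ u⊏c₃)
    row-of-gap 3F c₄≺u before with gap₄ c₄≺u (before 4F ≤-refl)
    ... | c₇⊏u , u⊏c₄ = in-row-above 3F 6F c₇⊏u (<⇒≤ u⊏c₄)
    row-of-gap 4F c₅≺u before = in-lowest-row (<⇒≤ (gap₅ c₅≺u (before 5F ≤-refl)))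
    row-of-gap 5F c₆≺u before with gap₆ c₆≺u (before 6F ≤-refl)
    ... | c₁⊏u , u⊏c₆ = in-row-above 5F 0F c₁⊏u (<⇒≤ u⊏c₆)
    row-of-gap 6F c₇≺u _ with gap₇ c₇≺u
    ... | c₂⊏u , u⊏c₇ = in-row-above 6F 1F c₂⊏u (<⇒≤ u⊏c₇)

    row-of-block : ∀ k {u} → InBlock k u → InRow k u
    row-of-block k {u} (k≼u , before) with point k ≟ᶠ u
    ... | yes refl = own-row k
    ... | no k≢u = row-of-gap k (≼∧≢⇒≺ k≼u k≢u) before

    locate : ∀ u → Σ (Fin 7) λ k → InBlock k u
    locate u = block-of point point-increasing (≮⇒≥ gap₀)

    InBlock? : ∀ k → Decidable (InBlock k)
    InBlock? k u = (toℕ (point k) ≤? toℕ u) ×-dec all? λ j → (toℕ k <? toℕ j) →-dec (u ≺? point j)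

    block-convex : ∀ k → Convex (InBlock k)
    block-convex k = record
      { between-positions = λ (k≼a , _) (_ , before) a≼u u≼b →
          ≤-trans k≼a a≼u , λ j k<j → ≤-<-trans u≼b (before j k<j)
      ; between-values    = between-values
      }
      where
      between-values : ∀ {a b u} → InBlock k a → InBlock k b → a ⊑ u → u ⊑ b → InBlock k u
      between-values {u = u} ka kb a⊑u u⊑b with locate u
      ... | j , ju = subst (λ i → InBlock i u) (rows-disjoint (row-of-block j ju) row-u) ju
        where
        row-u : InRow k u
        row-u = (λ i i<k → <-≤-trans (proj₁ (row-of-block k ka) i i<k) a⊑u)
              , ≤-trans u⊑b (proj₂ (row-of-block k kb))

    not-every-block : ∀ k → Σ (Fin n) λ p → ¬ InBlock k p
    not-every-block 0F = c₂ , λ (_ , before) → <-irrefl refl (before 1F ≤-refl)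
    not-every-block (Fin.suc k) = c₁ , λ (k≼c₁ , _) → <⇒≱ (point-increasing 0F (Fin.suc k) (s≤s z≤n)) k≼c₁

    block-singleton : ∀ k {u} → InBlock k u → u ≡ point k
    block-singleton k {u} ku with u ≟ᶠ point k
    ... | yes u≡k = u≡k
    ... | no u≢k = ⊥-elim (proj₂ (not-every-block k)
          (simple⇒convex-everything simple (InBlock k) (InBlock? k) (block-convex k) ku (own-block k) u≢k _))

    next-position-outside : ∀ k {p} → toℕ p ≡ suc (toℕ (point k)) → ¬ InBlock k p
    next-position-outside k at-next kp = 1+n≢n (trans (sym at-next) (cong toℕ (block-singleton k kp)))

    no-point-between : ∀ i → suc (toℕ (point (inject₁ i))) ≡ toℕ (point (Fin.suc i))
    no-point-between i = ≤-antisym (point-increasing (inject₁ i) (Fin.suc i) i<i+1) (≮⇒≥ λ gap →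
      let p<n = <-trans gap (toℕ<n _)
          at-next = toℕ-fromℕ< p<n
      in next-position-outside (inject₁ i) at-next
           ( subst (toℕ (point (inject₁ i)) ≤_) (sym at-next) (n≤1+n _)
           , λ j i<j → <-≤-trans (subst (_< toℕ (point (Fin.suc i))) (sym at-next) gap)
                                 (increasing⇒≼ point-increasing (subst (_< toℕ j) (toℕ-inject₁ i) i<j)) ))
      where
      i<i+1 : toℕ (inject₁ i) < toℕ (Fin.suc i)
      i<i+1 = s≤s (≤-reflexive (toℕ-inject₁ i))

    no-point-after : suc (toℕ c₇) ≡ n
    no-point-after = ≤-antisym (toℕ<n c₇) (≮⇒≥ λ gap →
      let at-next = toℕ-fromℕ< gap
      in next-position-outside 6F at-next
           ( subst (toℕ c₇ ≤_) (sym at-next) (n≤1+n _)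
           , λ j 6<j → ⊥-elim (<⇒≱ 6<j (s≤s⁻¹ (toℕ<n j))) ))

    no-point-before : toℕ c₁ ≡ 0
    no-point-before = n≤0⇒n≡0 (≮⇒≥ λ 0<c₁ →
      gap₀ (subst (_< toℕ c₁) (sym (toℕ-fromℕ< (<-trans 0<c₁ (toℕ<n c₁)))) 0<c₁))

    positions : ∀ k → toℕ (point k) ≡ toℕ k
    positions k = trans (successor-chain (toℕ ∘ point) no-point-between k) (cong (_+ toℕ k) no-point-before)

    length : n ≡ 7
    length = trans (sym no-point-after) (cong suc (positions 6F))

    values : ∀ k → suc (val σ (point k)) ≡ lookup w5274163 k
    values k with proj₂ w5274163-ordered k
    ... | r , refl = trans (cong suc (chain-squeeze 0 (val σ ∘ point ∘ w5274163-order) by-value z≤n c₃≤6 r))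
                           (sym (proj₁ w5274163-ordered r))
      where
      c₃≤6 : val σ c₃ ≤ 6
      c₃≤6 = s≤s⁻¹ (subst (val σ c₃ <_) length (toℕ<n _))

    is-5274163 : IsWord σ w5274163
    is-5274163 = isWord σ w5274163 point positions length values

proposition3 : ∀ {n} (σ : Perm n) → Simple σ → Avoids σ p2341 → Avoids σ p4123 →
    Contains σ p123 → Contains σ p3412 → IsWord σ w5274163
proposition3 σ simple avoids-2341 avoids-4123 contains-123 contains-3412
  with Points.3412-points σ contains-3412 | Points.123-points σ contains-123
... | a , b , c , d , is-3412 | x , y , z , is-123
  with Points.extremal-copy σ (Interleaving.copy simple avoids-2341 avoids-4123 is-3412 is-123)
... | K , extremal = Blocks.is-5274163 simple avoids-2341 avoids-4123 K extremal
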